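{- Let $n>3$ be an integer such that $p=4n-1$ is prime. Let \[A_{[)}=\{k\in\{2,\dots,n+2\}: 3n-k-1\le r_p((k-1)^2)<3n+k-3\},\qquad B_{[)}=\{k\in\{n+3,\dots,2n\}: k-n-2\le r_p((k-1)^2)<3n-k-1\},\] and let $y,z$ be the two largest elements of $A_{[)}$. For $k\in A_{[)}\setminus\{y,z\}$ let $m=\lfloor (k-1)^2/p\rfloor$ and let $u_0=u_0(k)$ be the least integer $x\in\{0,1,\dots,n+2\}$ satisfying $(m+1)p\le (k+x-1)^2+1$. Then the map $f:A_{[)}\setminus\{y,z\}\to B_{[)}$, $f(k)=2n+2-u_0(k)-k$, is well defined and bijective.
   Context: For a positive integer $q$ and $x\in\mathbb{Z}$, $r_q(x)\in\{0,1,\dots,q-1\}$ denotes the remainder of $x$ upon division by $q$. -}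

module Defs where

open import Data.Nat using (ℕ; zero; suc; _+_; _*_; _∸_; _^_; _≤_; _<_)
open import Data.Nat.DivMod using (_%_; _/_)
open import Data.Product using (_×_; Σ-syntax)
open import Relation.Nullary using (¬_)
open import Relation.Binary.PropositionalEquality using (_≢_)

-- r_q(x) : remainder of x upon division by q (q positive; the q = 0 clause is
-- a never-used convention, since q = p = 4n-1 > 0 below).
rem : ℕ → ℕ → ℕ
rem x zero    = x
rem x (suc q) = x % suc q

-- floor(x / q)  (again q = 0 clause is a never-used convention)
quot : ℕ → ℕ → ℕ
quot x zero    = 0
quot x (suc q) = x / suc q

pOf : ℕ → ℕ
pOf n = 4 * n ∸ 1

-- k ∈ A_[) :  k ∈ {2,…,n+2}  and  3n-k-1 ≤ r_p((k-1)^2) < 3n+k-3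
-- (for k ≤ n+2, n > 3 the truncated subtractions agree with integer ones)
InA : ℕ → ℕ → Set
InA n k = 2 ≤ k × k ≤ n + 2
        × (3 * n ∸ k ∸ 1 ≤ rem ((k ∸ 1) ^ 2) (pOf n))
        × (rem ((k ∸ 1) ^ 2) (pOf n) < 3 * n + k ∸ 3)

InB : ℕ → ℕ → Set
InB n k = n + 3 ≤ k × k ≤ 2 * n
        × (k ∸ n ∸ 2 ≤ rem ((k ∸ 1) ^ 2) (pOf n))
        × (rem ((k ∸ 1) ^ 2) (pOf n) < 3 * n ∸ k ∸ 1)

TwoLargest : ℕ → ℕ → ℕ → Set
TwoLargest n y z = InA n y × InA n z × z < y
                 × (∀ k → InA n k → k ≢ y → k ≢ z → k < z)

InA' : ℕ → ℕ → ℕ → ℕ → Set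
InA' n y z k = InA n k × k ≢ y × k ≢ z

mOf : ℕ → ℕ → ℕ
mOf n k = quot ((k ∸ 1) ^ 2) (pOf n)

U0Cond : ℕ → ℕ → ℕ → Set
U0Cond n k x = (mOf n k + 1) * pOf n ≤ (k + x ∸ 1) ^ 2 + 1

IsU0 : ℕ → ℕ → ℕ → Set
IsU0 n k u = u ≤ n + 2 × U0Cond n k u × (∀ x → x < u → ¬ U0Cond n k x)

fVal : ℕ → ℕ → ℕ → ℕ
fVal n k u = 2 * n + 2 ∸ u ∸ k

-- Let p = 4n − 1 and, for k ∈ A_[), call M = ⌊(k − 1)²/p⌋ + 1 the level of k. The two
-- inequalities defining A_[) say precisely that a = k − 1 is the integer nearest to
-- √(Mp − n − 1), that is a² − a < Mp − n − 1 ≤ a² + a. These windows are disjoint and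
-- shorter than p, so A_[) corresponds bijectively to the levels 1, …, T + 2 with
-- T = ⌊(n − 2)²/p⌋, and y, z are its elements on the levels T + 2 and T + 1.
-- For k′ = 2n + 1 − b one has (k′ − 1)² ≡ b² + n − b (mod p), and the inequalities defining
-- B_[) become (b − 1)² + 1 < Mp ≤ b² for some level M. Because p ≡ 3 (mod 4), Fermat's little
-- theorem shows that p never divides x² + 1; hence for every level M there is exactly one
-- such b, namely the least x with Mp ≤ x² + 1, and B_[) corresponds to the levels 1, …, T.
-- For k ∈ A_[) ∖ {y, z} on level M this b is (k − 1) + u₀(k), so f(k) = 2n + 1 − b is the
-- composite of the two correspondences.

module Submission where

open import Data.Nat
open import Data.Nat.Properties
open import Data.Nat.DivMod
  using (_%_; _/_; m≡m%n+[m/n]*n; m%n<n; [m+kn]%n≡m%n; m<n⇒m%n≡m; %-congʳ; /-congʳ; %-distribˡ-+; %-distribˡ-*;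
         m*n/n≡m; /-monoˡ-≤; m/n*n≤m; m/n*n≡m)
open import Data.Nat.Divisibility
open import Data.Nat.Primality using (Prime; euclidsLemma; prime⇒nonZero; prime⇒nonTrivial)
open import Data.Nat.Combinatorics using (_C_; nCn≡1; nCk≡n!/k![n-k]!; k![n∸k]!∣n!)
open import Data.Nat.Tactic.RingSolver using (solve-∀)
open import Data.Fin.Base as Fin using (toℕ; inject₁; fromℕ)
open import Data.Fin.Properties using (toℕ<n; toℕ-inject₁; toℕ-fromℕ)
open import Data.Vec.Functional using (Vector; head; tail; last; init)
open import Data.Product using (Σ-syntax; ∃; ∃₂; _×_; _,_; proj₁; proj₂)
open import Data.Sum using (_⊎_; inj₁; inj₂)
open import Relation.Nullary using (¬_; contradiction; yes; no)
open import Relation.Binary.PropositionalEquality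
open import Relation.Binary.Definitions using (tri<; tri≈; tri>)
open import Relation.Binary.Bundles using (Setoid)
import Relation.Binary.Reasoning.Setoid as SetoidReasoning
open import Function.Base using (_∘_; case_of_)
open import Function.Bundles using (_⇔_; mk⇔; Equivalence)
open import Level using (0ℓ)
import Algebra.Properties.CommutativeSemiring.Binomial +-*-commutativeSemiring as Binomial
import Algebra.Definitions.RawSemiring +-*-rawSemiring as Semiringℕ
open import Algebra.Properties.Monoid.Sum +-0-monoid using (sum; sum-init-last)

open import Defs

infix 4 _≡_mod_
record _≡_mod_ (a b d : ℕ) : Set where
  constructor mod-intro
  field rem≡rem : rem a d ≡ rem b d

≡-mod-refl : ∀ {d a} → a ≡ a mod d
≡-mod-refl = mod-intro refl

≡-mod-sym : ∀ {d a b} → a ≡ b mod d → b ≡ a mod d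
≡-mod-sym (mod-intro eq) = mod-intro (sym eq)

≡-mod-trans : ∀ {d a b c} → a ≡ b mod d → b ≡ c mod d → a ≡ c mod d
≡-mod-trans (mod-intro eq₁) (mod-intro eq₂) = mod-intro (trans eq₁ eq₂)

mod-setoid : ℕ → Setoid 0ℓ 0ℓ
mod-setoid d = record
  { Carrier = ℕ
  ; _≈_ = λ a b → a ≡ b mod d
  ; isEquivalence = record
    { refl = ≡-mod-refl
    ; sym = ≡-mod-sym
    ; trans = ≡-mod-trans
    }
  }

+-cong-mod : ∀ {d a b c e} → a ≡ b mod d → c ≡ e mod d → a + c ≡ b + e mod d
+-cong-mod {zero} (mod-intro a≡b) (mod-intro c≡e) = mod-intro (cong₂ _+_ a≡b c≡e)
+-cong-mod {suc d} {a} {b} {c} {e} (mod-intro a≡b) (mod-intro c≡e) = mod-intro (begin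
    (a + c) % suc d
  ≡⟨ %-distribˡ-+ a c (suc d) ⟩
    (a % suc d + c % suc d) % suc d
  ≡⟨ cong₂ (λ x y → (x + y) % suc d) a≡b c≡e ⟩
    (b % suc d + e % suc d) % suc d
  ≡⟨ %-distribˡ-+ b e (suc d) ⟨
    (b + e) % suc d ∎)
  where open ≡-Reasoning

*-cong-mod : ∀ {d a b c e} → a ≡ b mod d → c ≡ e mod d → a * c ≡ b * e mod d
*-cong-mod {zero} (mod-intro a≡b) (mod-intro c≡e) = mod-intro (cong₂ _*_ a≡b c≡e)
*-cong-mod {suc d} {a} {b} {c} {e} (mod-intro a≡b) (mod-intro c≡e) = mod-intro (begin
    (a * c) % suc d
  ≡⟨ %-distribˡ-* a c (suc d) ⟩
    (a % suc d * (c % suc d)) % suc d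
  ≡⟨ cong₂ (λ x y → (x * y) % suc d) a≡b c≡e ⟩
    (b % suc d * (e % suc d)) % suc d
  ≡⟨ %-distribˡ-* b e (suc d) ⟨
    (b * e) % suc d ∎)
  where open ≡-Reasoning

^-cong-mod : ∀ {d a b} n → a ≡ b mod d → a ^ n ≡ b ^ n mod d
^-cong-mod zero a≡b = mod-intro refl
^-cong-mod (suc n) a≡b = *-cong-mod a≡b (^-cong-mod n a≡b)

∣⇒≡0-mod : ∀ {d a} → d ∣ a → a ≡ 0 mod d
∣⇒≡0-mod {zero} d∣a = mod-intro (0∣⇒≡0 d∣a)
∣⇒≡0-mod {suc d} {a} d∣a = mod-intro (n∣m⇒m%n≡0 a (suc d) d∣a)

≡0-mod⇒∣ : ∀ {d a} → a ≡ 0 mod d → d ∣ a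
≡0-mod⇒∣ {zero} (mod-intro a≡0) = subst (0 ∣_) (sym a≡0) (0 ∣0)
≡0-mod⇒∣ {suc d} {a} (mod-intro a≡0) = m%n≡0⇒n∣m a (suc d) a≡0

-- Fermat's little theorem and the residue −1

^-semiring≡^ : ∀ x n → x Semiringℕ.^ n ≡ x ^ n
^-semiring≡^ x zero = refl
^-semiring≡^ x (suc n) = cong (x *_) (^-semiring≡^ x n)

×-semiring≡* : ∀ n x → n Semiringℕ.× x ≡ n * x
×-semiring≡* zero x = refl
×-semiring≡* (suc n) x = cong (x +_) (×-semiring≡* n x)

∣-sum : ∀ {d n} (t : Vector ℕ n) → (∀ i → d ∣ t i) → d ∣ sum t
∣-sum {d} {zero} t d∣t = d ∣0
∣-sum {d} {suc n} t d∣t = ∣m∣n⇒∣m+n (d∣t _) (∣-sum (tail t) (d∣t ∘ Fin.suc))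

sum≡ends+middle : ∀ {n} (t : Vector ℕ (2 + n)) → sum t ≡ head t + sum (init (tail t)) + last t
sum≡ends+middle t = trans (cong (head t +_) (sum-init-last (tail t))) (sym (+-assoc (head t) _ _))

binomialTerm≡nCk*x^k : ∀ x n k → Binomial.binomialTerm x 1 n k ≡ (n C toℕ k) * x ^ toℕ k
binomialTerm≡nCk*x^k x n k = begin
    (n C toℕ k) Semiringℕ.× (x Semiringℕ.^ toℕ k * 1 Semiringℕ.^ (n ∸ toℕ k))
  ≡⟨ ×-semiring≡* (n C toℕ k) _ ⟩
    (n C toℕ k) * (x Semiringℕ.^ toℕ k * 1 Semiringℕ.^ (n ∸ toℕ k))
  ≡⟨ cong (λ y → (n C toℕ k) * (y * 1 Semiringℕ.^ (n ∸ toℕ k))) (^-semiring≡^ x (toℕ k)) ⟩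
    (n C toℕ k) * (x ^ toℕ k * 1 Semiringℕ.^ (n ∸ toℕ k))
  ≡⟨ cong (λ y → (n C toℕ k) * (x ^ toℕ k * y)) (trans (^-semiring≡^ 1 (n ∸ toℕ k)) (^-zeroˡ (n ∸ toℕ k))) ⟩
    (n C toℕ k) * (x ^ toℕ k * 1)
  ≡⟨ cong ((n C toℕ k) *_) (*-identityʳ (x ^ toℕ k)) ⟩
    (n C toℕ k) * x ^ toℕ k ∎
  where open ≡-Reasoning

n∣n! : ∀ n → .{{NonZero n}} → n ∣ n !
n∣n! (suc n) = m∣m*n (n !)

module _ {p} (pr : Prime p) where

  prime∤! : ∀ k → k < p → ¬ p ∣ k !
  prime∤! zero k<p p∣1 = nonTrivial⇒≢1 {{prime⇒nonTrivial pr}} (∣1⇒≡1 p∣1)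
  prime∤! (suc k) k<p p∣k! with euclidsLemma (suc k) (k !) pr p∣k!
  ... | inj₁ p∣k = <⇒≱ k<p (∣⇒≤ p∣k)
  ... | inj₂ p∣k! = prime∤! k (<⇒≤ k<p) p∣k!

  prime∣pCk : ∀ {k} → 0 < k → k < p → p ∣ p C k
  prime∣pCk {k} 0<k k<p with euclidsLemma (p C k) (k ! * (p ∸ k) !) pr p∣product
    where
      instance _ = k !* (p ∸ k) !≢0
      product≡p! : (p C k) * (k ! * (p ∸ k) !) ≡ p !
      product≡p! = trans (cong (_* (k ! * (p ∸ k) !)) (nCk≡n!/k![n-k]! (<⇒≤ k<p))) (m/n*n≡m (k![n∸k]!∣n! (<⇒≤ k<p)))
      p∣product : p ∣ (p C k) * (k ! * (p ∸ k) !)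
      p∣product = subst (p ∣_) (sym product≡p!) (n∣n! p {{prime⇒nonZero pr}})
  ... | inj₁ p∣pCk = p∣pCk
  ... | inj₂ p∣k![p∸k]! with euclidsLemma (k !) ((p ∸ k) !) pr p∣k![p∸k]!
  ...   | inj₁ p∣k! = contradiction p∣k! (prime∤! k k<p)
  ...   | inj₂ p∣[p∸k]! = contradiction p∣[p∸k]! (prime∤! (p ∸ k) (∸-monoʳ-< 0<k (<⇒≤ k<p)))

[x+1]^n≡1+middle+x^n : ∀ q x → let n = 2 + q in (x + 1) ^ n ≡ 1 + sum (init (tail (Binomial.binomialTerm x 1 n))) + x ^ n
[x+1]^n≡1+middle+x^n q x = begin
    (x + 1) ^ n                  ≡⟨ ^-semiring≡^ (x + 1) n ⟨
    (x + 1) Semiringℕ.^ n        ≡⟨ Binomial.theorem n x 1 ⟩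
    sum t                        ≡⟨ sum≡ends+middle t ⟩
    head t + middle + last t     ≡⟨ cong₂ (λ a b → a + middle + b) (binomialTerm≡nCk*x^k x n Fin.zero) last≡x^n ⟩
    1 + middle + x ^ n           ∎
  where
    open ≡-Reasoning
    n = 2 + q
    t = Binomial.binomialTerm x 1 n
    middle = sum (init (tail t))
    last≡x^n : last t ≡ x ^ n
    last≡x^n = begin
        last t                                    ≡⟨ binomialTerm≡nCk*x^k x n (fromℕ n) ⟩
        (n C toℕ (fromℕ n)) * x ^ toℕ (fromℕ n)   ≡⟨ cong (λ k → (n C k) * x ^ k) (toℕ-fromℕ n) ⟩
        (n C n) * x ^ n                           ≡⟨ cong (_* x ^ n) (nCn≡1 n) ⟩
        1 * x ^ n                                 ≡⟨ *-identityˡ (x ^ n) ⟩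
        x ^ n                                     ∎

freshman : ∀ {p} → Prime p → ∀ x → (x + 1) ^ p ≡ x ^ p + 1 mod p
freshman {0} ()
freshman {1} ()
freshman {p@(suc (suc q))} pr x = begin
    (x + 1) ^ p          ≡⟨ [x+1]^n≡1+middle+x^n q x ⟩
    1 + middle + x ^ p   ≈⟨ +-cong-mod (+-cong-mod (≡-mod-refl {a = 1}) (∣⇒≡0-mod p∣middle)) (≡-mod-refl {a = x ^ p}) ⟩
    1 + 0 + x ^ p        ≡⟨ +-comm 1 (x ^ p) ⟩
    x ^ p + 1            ∎
  where
    open SetoidReasoning (mod-setoid p)
    t = Binomial.binomialTerm x 1 p
    middle = sum (init (tail t))
    p∣middle : p ∣ middle
    p∣middle = ∣-sum (init (tail t)) λ i → subst (p ∣_) (sym (binomialTerm≡nCk*x^k x p (Fin.suc (inject₁ i))))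
      (∣m⇒∣m*n _ (prime∣pCk pr (s≤s z≤n) (s≤s (subst (_< suc q) (sym (toℕ-inject₁ i)) (toℕ<n i)))))

fermat : ∀ {p} → Prime p → ∀ x → x ^ p ≡ x mod p
fermat {zero} ()
fermat {suc q} pr zero = ≡-mod-refl
fermat {p@(suc q)} pr (suc x) = begin
    suc x ^ p     ≡⟨ cong (_^ p) (+-comm 1 x) ⟩
    (x + 1) ^ p   ≈⟨ freshman pr x ⟩
    x ^ p + 1     ≈⟨ +-cong-mod (fermat pr x) (≡-mod-refl {a = 1}) ⟩
    x + 1         ≡⟨ +-comm x 1 ⟩
    suc x         ∎
  where open SetoidReasoning (mod-setoid p)

prime≡3mod4⇒∤x*x+1 : ∀ {p n} → Prime p → p + 1 ≡ 4 * n → ∀ x → ¬ p ∣ x * x + 1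
prime≡3mod4⇒∤x*x+1 {p} {n} pr p+1≡4n x p∣x*x+1 = p∤2 n p+1≡4n (≡0-mod⇒∣ 2≡0)
  where
    open SetoidReasoning (mod-setoid p)
    s = x * x
    s+1≡0 : s + 1 ≡ 0 mod p
    s+1≡0 = ∣⇒≡0-mod p∣x*x+1
    -- s² ≡ 1 from s(s + 1) ≡ 0 and s + 1 ≡ 0, avoiding negative numbers
    s*s≡1 : s * s ≡ 1 mod p
    s*s≡1 = begin
        s * s             ≡⟨ +-identityʳ (s * s) ⟨
        s * s + 0         ≈⟨ +-cong-mod (≡-mod-refl {a = s * s}) s+1≡0 ⟨
        s * s + (s + 1)   ≡⟨ factor s ⟩
        s * (s + 1) + 1   ≈⟨ +-cong-mod (*-cong-mod (≡-mod-refl {a = s}) s+1≡0) (≡-mod-refl {a = 1}) ⟩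
        s * 0 + 1         ≡⟨ cong (_+ 1) (*-zeroʳ s) ⟩
        1                 ∎
      where factor : ∀ s → s * s + (s + 1) ≡ s * (s + 1) + 1
            factor = solve-∀
    s≡1 : s ≡ 1 mod p
    s≡1 = begin
        x * x             ≈⟨ *-cong-mod (≡-mod-refl {a = x}) (fermat pr x) ⟨
        x * x ^ p         ≡⟨ cong (x ^_) (trans (+-comm 1 p) p+1≡4n) ⟩
        x ^ (4 * n)       ≡⟨ ^-*-assoc x 4 n ⟨
        (x ^ 4) ^ n       ≡⟨ cong (_^ n) (x⁴≡s*s x) ⟩
        (s * s) ^ n       ≈⟨ ^-cong-mod n s*s≡1 ⟩
        1 ^ n             ≡⟨ ^-zeroˡ n ⟩
        1                 ∎
      where x⁴≡s*s : ∀ y → y * (y * (y * (y * 1))) ≡ (y * y) * (y * y)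
            x⁴≡s*s = solve-∀
    2≡0 : 2 ≡ 0 mod p
    2≡0 = begin
        2                 ≈⟨ +-cong-mod s≡1 (≡-mod-refl {a = 1}) ⟨
        s + 1             ≈⟨ s+1≡0 ⟩
        0                 ∎
    p∤2 : ∀ n → p + 1 ≡ 4 * n → ¬ p ∣ 2
    p∤2 zero    p+1≡0  _   = 1+n≢0 (trans (+-comm 1 p) p+1≡0)
    p∤2 (suc _) p+1≡4n p∣2 =
      contradiction {A = 4 ≤ 3}
        (≤-trans (*-monoʳ-≤ 4 (s≤s z≤n)) (≤-trans (≤-reflexive (sym p+1≡4n)) (+-monoˡ-≤ 1 (∣⇒≤ p∣2))))
        (<⇒≱ (n<1+n 3))

-- Linear inequalities are added up with _⊕_ and compared through a ring identity proved by solve-∀.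
infixl 6 _⊕_
_⊕_ : ∀ {a b c d} → a ≤ b → c ≤ d → a + c ≤ b + d
_⊕_ = +-mono-≤

≤-transfer : ∀ {a b x y} → a ≤ b → x + b ≡ y + a → x ≤ y
≤-transfer {a} {b} {x} {y} a≤b eq = +-cancelʳ-≤ b x y (≤-trans (≤-reflexive eq) (+-monoʳ-≤ y a≤b))

+≡⇒≤ : ∀ {x y} j → x + j ≡ y → x ≤ y
+≡⇒≤ {x} j refl = m≤m+n x j

≤⇒≢+suc : ∀ {a b} j → a ≤ b → a ≢ b + suc j
≤⇒≢+suc {a} {b} j a≤b refl = <⇒≱ (m<m+n b (s≤s z≤n)) a≤b

∸≤⇒≤+ : ∀ x y {z} → x ∸ y ≤ z → x ≤ y + z
∸≤⇒≤+ x y x∸y≤z = ≤-trans (m≤n+m∸n x y) (+-monoʳ-≤ y x∸y≤z)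

<∸⇒+< : ∀ {x y} z → x < y ∸ z → x + z < y
<∸⇒+< {x} {y} z x<y∸z with z ≤? y
... | yes z≤y = ≤-trans (+-monoˡ-≤ z x<y∸z) (≤-reflexive (m∸n+n≡m z≤y))
... | no z≰y = contradiction (subst (x <_) (m≤n⇒m∸n≡0 (<⇒≤ (≰⇒> z≰y))) x<y∸z) (λ ())

x^2≡x*x : ∀ x → x ^ 2 ≡ x * x
x^2≡x*x x = cong (x *_) (*-identityʳ x)

∸-by : ∀ {x y z} → x ≡ y + z → x ∸ y ≡ z
∸-by {y = y} {z} refl = m+n∸m≡n y z

remainder-quotient-unique : ∀ {x r q d} .{{_ : NonZero d}} → x ≡ r + q * d → r < d → x % d ≡ r × x / d ≡ q
remainder-quotient-unique {x} {r} {q} {d} x≡r+qd r<d = x%d≡r , *-cancelʳ-≡ (x / d) q d (+-cancelˡ-≡ r _ _ r+[x/d]d≡r+qd)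
  where
    x%d≡r : x % d ≡ r
    x%d≡r = trans (cong (_% d) x≡r+qd) (trans ([m+kn]%n≡m%n r q d) (m<n⇒m%n≡m r<d))
    r+[x/d]d≡r+qd : r + x / d * d ≡ r + q * d
    r+[x/d]d≡r+qd = trans (cong (_+ x / d * d) (sym x%d≡r)) (trans (sym (m≡m%n+[m/n]*n x d)) x≡r+qd)

*≤⇒≤/ : ∀ {M x d} .{{_ : NonZero d}} → M * d ≤ x → M ≤ x / d
*≤⇒≤/ {M} {x} {d} Md≤x = subst (_≤ x / d) (m*n/n≡m M d) (/-monoˡ-≤ d Md≤x)

≤/⇒*≤ : ∀ {M x d} .{{_ : NonZero d}} → M ≤ x / d → M * d ≤ x
≤/⇒*≤ {M} {x} {d} M≤x/d = ≤-trans (*-monoˡ-≤ d M≤x/d) (m/n*n≤m x d)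

-- Nearest and ceiling square roots

-- a² - a < Y - c ≤ a² + a, kept free of subtraction
RoundRoot : ℕ → ℕ → ℕ → Set
RoundRoot c Y a = a * a + c < Y + a × Y ≤ a * a + a + c

roundRoot-positive : ∀ {c Y a} → RoundRoot c Y a → 0 < a
roundRoot-positive {a = zero} (lower , upper) = contradiction (≤-trans lower (≤-reflexive (+-identityʳ _))) (≤⇒≯ upper)
roundRoot-positive {a = suc a} _ = s≤s z≤n

roundRoot-above : ∀ {c Y a} → RoundRoot c Y a → c < Y
roundRoot-above {c} {Y} {a} (lower , _) = ≤-transfer (lower ⊕ a≤a*a a) (shift a c Y)
  where
    a≤a*a : ∀ a → a ≤ a * a
    a≤a*a zero = z≤n
    a≤a*a (suc a) = m≤m*n (suc a) (suc a)
    shift : ∀ a c Y → suc c + (Y + a + a * a) ≡ Y + (suc (a * a + c) + a)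
    shift = solve-∀

roundRoot-step : ∀ {c Y a} → RoundRoot c Y a → RoundRoot c (suc Y) a ⊎ RoundRoot c (suc Y) (suc a)
roundRoot-step {c} {Y} {a} (lower , upper) with m≤n⇒m<n∨m≡n upper
... | inj₁ Y<max = inj₁ (m<n⇒m<1+n lower , Y<max)
... | inj₂ refl = inj₂ (+≡⇒≤ 0 (next-lower a c) , +≡⇒≤ (a + a + 1) (next-upper a c))
  where
    next-lower : ∀ a c → suc (suc a * suc a + c) + 0 ≡ suc (a * a + a + c) + suc a
    next-lower = solve-∀
    next-upper : ∀ a c → suc (a * a + a + c) + (a + a + 1) ≡ suc a * suc a + suc a + c
    next-upper = solve-∀

roundRoot-exists : ∀ {c Y} → c < Y → ∃ (RoundRoot c Y)
roundRoot-exists {c} {suc Y} (s≤s c≤Y) with m≤n⇒m<n∨m≡n c≤Y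
... | inj₁ c<Y with roundRoot-step (proj₂ (roundRoot-exists c<Y))
...   | inj₁ root = _ , root
...   | inj₂ root = _ , root
roundRoot-exists {c} {suc Y} (s≤s c≤Y) | inj₂ refl = 1 , +≡⇒≤ 0 (lower c) , +≡⇒≤ 1 (upper c)
  where
    lower : ∀ c → suc (1 * 1 + c) + 0 ≡ suc c + 1
    lower = solve-∀
    upper : ∀ c → suc c + 1 ≡ 1 * 1 + 1 + c
    upper = solve-∀

roundRoot-mono-≤ : ∀ {c Y Y′ a a′} → RoundRoot c Y a → RoundRoot c Y′ a′ → Y ≤ Y′ → a ≤ a′
roundRoot-mono-≤ {c} {Y} {Y′} {a} {a′} (lower , _) (_ , upper′) Y≤Y′ with a ≤? a′
... | yes a≤a′ = a≤a′
... | no a≰a′ with m≤n⇒∃[o]m+o≡n (≰⇒> a≰a′)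
...   | d , refl = contradiction (excess a′ d c Y Y′) (≤⇒≢+suc (2 * a′ * d + d + d * d) (lower ⊕ Y≤Y′ ⊕ upper′))
  where
    excess : ∀ a′ d c Y Y′ → suc ((suc a′ + d) * (suc a′ + d) + c) + Y + Y′
                           ≡ Y + (suc a′ + d) + Y′ + (a′ * a′ + a′ + c) + suc (2 * a′ * d + d + d * d)
    excess = solve-∀

roundRoot-unique : ∀ {c Y a a′} → RoundRoot c Y a → RoundRoot c Y a′ → a ≡ a′
roundRoot-unique root root′ = ≤-antisym (roundRoot-mono-≤ root root′ ≤-refl) (roundRoot-mono-≤ root′ root ≤-refl)

roundRoot-mono-< : ∀ {c Y Y′ a a′} → RoundRoot c Y a → RoundRoot c Y′ a′ → Y + (a + a) ≤ Y′ → a < a′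
roundRoot-mono-< {c} {Y} {Y′} {a} {a′} (lower , _) (_ , upper′) gap with a <? a′
... | yes a<a′ = a<a′
... | no a≮a′ = contradiction (excess a c Y Y′) (≤⇒≢+suc 0 (lower ⊕ gap ⊕ ≤-trans upper′ (top-mono (≮⇒≥ a≮a′))))
  where
    top-mono : a′ ≤ a → a′ * a′ + a′ + c ≤ a * a + a + c
    top-mono a′≤a = +-monoˡ-≤ c (*-mono-≤ a′≤a a′≤a ⊕ a′≤a)
    excess : ∀ a c Y Y′ → suc (a * a + c) + (Y + (a + a)) + Y′ ≡ Y + a + Y′ + (a * a + a + c) + suc 0
    excess = solve-∀

roundRoot-below : ∀ {c Y a x} → RoundRoot c Y a → 0 < c → x < a → x * x + 1 < Y
roundRoot-below {c} {Y} {a} {x} (lower , _) 0<c x<a with m≤n⇒∃[o]m+o≡n x<a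
... | d , refl = m+n≤o⇒m≤o _ (≤-transfer (lower ⊕ 0<c) (shift x d c Y))
  where
    shift : ∀ x d c Y → suc (x * x + 1) + (x + 2 * x * d + d * d + d) + (Y + (suc x + d) + c)
                      ≡ Y + (suc ((suc x + d) * (suc x + d) + c) + 1)
    shift = solve-∀

-- (b - 1)² + 1 < Y ≤ b², kept free of subtraction
CeilRoot : ℕ → ℕ → Set
CeilRoot Y b = Y ≤ b * b × b * b + 3 ≤ Y + (b + b)

ceilRoot-below : ∀ {Y b x} → CeilRoot Y b → x < b → x * x + 1 < Y
ceilRoot-below {Y} {b} {x} (_ , lower) x<b with m≤n⇒∃[o]m+o≡n x<b
... | d , refl = m+n≤o⇒m≤o _ (≤-transfer lower (shift x d Y))
  where
    shift : ∀ x d Y → suc (x * x + 1) + (2 * x * d + d * d) + (Y + (suc x + d + (suc x + d)))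
                    ≡ Y + ((suc x + d) * (suc x + d) + 3)
    shift = solve-∀

ceilRoot-positive : ∀ {Y b} → CeilRoot Y b → 0 < b
ceilRoot-positive {zero} {zero} (_ , ())
ceilRoot-positive {suc Y} {zero} (() , _)
ceilRoot-positive {b = suc b} _ = s≤s z≤n

ceilRoot-above : ∀ {Y b} → CeilRoot Y b → 1 < Y
ceilRoot-above {Y} {zero} ceil = contradiction (ceilRoot-positive {Y} {zero} ceil) λ ()
ceilRoot-above {b = suc c} ceil = ≤-trans (s≤s (m≤n+m 1 (c * c))) (ceilRoot-below ceil (n<1+n c))

ceilRoot-width : ∀ {Y Y′ b} → CeilRoot Y b → CeilRoot Y′ b → Y′ + 3 ≤ Y + (b + b)
ceilRoot-width (_ , lower) (upper′ , _) = ≤-trans (+-monoˡ-≤ 3 upper′) lower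

ceilRoot-≤ : ∀ {Y b c} → CeilRoot Y b → Y ≤ c * c → b ≤ c
ceilRoot-≤ {Y} {b} {c} (_ , lower) Y≤c² with b ≤? c
... | yes b≤c = b≤c
... | no b≰c with m≤n⇒∃[o]m+o≡n (≰⇒> b≰c)
...   | d , refl = contradiction (excess c d Y) (≤⇒≢+suc (2 * c * d + d * d + 1) (lower ⊕ Y≤c²))
  where
    excess : ∀ c d Y → (suc c + d) * (suc c + d) + 3 + Y ≡ Y + (suc c + d + (suc c + d)) + c * c + suc (2 * c * d + d * d + 1)
    excess = solve-∀

ceilSqrt-exists : ∀ {Y} → 0 < Y → ∃ λ c → c * c < Y × Y ≤ suc c * suc c
ceilSqrt-exists {suc zero} _ = 0 , s≤s z≤n , s≤s z≤n
ceilSqrt-exists {suc (suc Y)} _ with ceilSqrt-exists {suc Y} (s≤s z≤n)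
... | c , below , above with m≤n⇒m<n∨m≡n above
...   | inj₁ Y<square = c , m<n⇒m<1+n below , Y<square
...   | inj₂ Y≡square = suc c , ≤-reflexive (cong suc (sym Y≡square)) , +≡⇒≤ (c + c + 2) (grow c Y Y≡square)
  where
    grow : ∀ c Y → suc Y ≡ suc c * suc c → suc (suc Y) + (c + c + 2) ≡ suc (suc c) * suc (suc c)
    grow c Y eq = trans (cong (λ z → suc z + (c + c + 2)) eq) (expand c)
      where
        expand : ∀ c → suc (suc c * suc c) + (c + c + 2) ≡ suc (suc c) * suc (suc c)
        expand = solve-∀

ceilRoot-intro : ∀ {Y c} → c * c + 1 < Y → Y ≤ suc c * suc c → CeilRoot Y (suc c)
ceilRoot-intro {Y} {c} below above = above , ≤-transfer below (shift c Y)
  where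
    shift : ∀ c Y → suc c * suc c + 3 + Y ≡ Y + (suc c + suc c) + suc (c * c + 1)
    shift = solve-∀

ceilRoot-exists : ∀ {Y} → (∀ x → Y ≢ x * x + 1) → 0 < Y → ∃ (CeilRoot Y)
ceilRoot-exists {Y} nonSquare+1 0<Y with ceilSqrt-exists 0<Y
... | c , below , above = suc c , ceilRoot-intro (≤∧≢⇒< (subst (_≤ Y) (+-comm 1 (c * c)) below) (≢-sym (nonSquare+1 c))) above

below-+ : ∀ {Y a u} → (∀ x → x < a → x * x + 1 < Y) → (∀ x → x < u → (a + x) * (a + x) + 1 < Y) →
          ∀ x → x < a + u → x * x + 1 < Y
below-+ {a = a} {u} below-a below-u x x<a+u with x <? a
... | yes x<a = below-a x x<a
... | no x≮a with m≤n⇒∃[o]m+o≡n (≮⇒≥ x≮a)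
...   | x′ , refl = below-u x′ (+-cancelˡ-< a x′ u x<a+u)

ceilRoot-least : ∀ {Y b} → (∀ x → Y ≢ x * x + 1) → 1 < Y → Y ≤ b * b + 1 → (∀ x → x < b → x * x + 1 < Y) → CeilRoot Y b
ceilRoot-least {Y} {zero} _ 1<Y Y≤1 _ = contradiction Y≤1 (<⇒≱ 1<Y)
ceilRoot-least {Y} {suc c} nonSquare+1 _ Y≤b²+1 below =
  ceilRoot-intro (below c ≤-refl) (m<1+n⇒m≤n (subst (Y <_) (+-comm (suc c * suc c) 1) (≤∧≢⇒< Y≤b²+1 (nonSquare+1 (suc c)))))

roundRoot-ceilRoot-< : ∀ {c Y a b} → RoundRoot c Y a → CeilRoot Y b → b ≤ c → a < b
roundRoot-ceilRoot-< {c} {Y} {a} {b} (lower , _) (upper , _) b≤c with a <? b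
... | yes a<b = a<b
... | no a≮b with m≤n⇒∃[o]m+o≡n (≮⇒≥ a≮b)
...   | zero , refl = contradiction (excess b c Y) (≤⇒≢+suc 0 (lower ⊕ upper ⊕ b≤c))
  where
    excess : ∀ b c Y → suc ((b + 0) * (b + 0) + c) + Y + b ≡ Y + (b + 0) + b * b + c + suc 0
    excess = solve-∀
...   | suc e , refl = contradiction (excess b e c Y) (≤⇒≢+suc (2 * b * e + 2 * b + e * e + e) (lower ⊕ upper ⊕ b≤c))
  where
    excess : ∀ b e c Y → suc ((b + suc e) * (b + suc e) + c) + Y + b
                       ≡ Y + (b + suc e) + b * b + c + suc (2 * b * e + 2 * b + e * e + e)
    excess = solve-∀

twoLargest-≤ : ∀ {n y z k} → TwoLargest n y z → InA n k → k ≤ y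
twoLargest-≤ {y = y} {z} {k} (_ , _ , z<y , below-z) inA with k ≟ y | k ≟ z
... | yes refl | _        = ≤-refl
... | no _     | yes refl = <⇒≤ z<y
... | no k≢y   | no k≢z   = <⇒≤ (<-trans (below-z k inA k≢y k≢z) z<y)

twoLargest-unique : ∀ {n y z y′ z′} → TwoLargest n y z → TwoLargest n y′ z′ → y ≡ y′ × z ≡ z′
twoLargest-unique {y = y} {z} {y′} {z′} tl@(inA-y , inA-z , z<y , below-z) tl′@(inA-y′ , inA-z′ , z′<y′ , below-z′)
  with ≤-antisym (twoLargest-≤ tl′ inA-y) (twoLargest-≤ tl inA-y′)
... | refl with z ≟ z′
...   | yes z≡z′ = refl , z≡z′
...   | no z≢z′ =
  contradiction (below-z′ z inA-z (<⇒≢ z<y) z≢z′) (<⇒≯ (below-z z′ inA-z′ (<⇒≢ z′<y′) (≢-sym z≢z′)))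

-- Levels

pOf[2+m] : ∀ m → pOf (2 + m) ≡ 7 + 4 * m
pOf[2+m] m = cong (_∸ 1) (four-n m)
  where
    four-n : ∀ m → 4 * (2 + m) ≡ 1 + (7 + 4 * m)
    four-n = solve-∀

rem-pOf : ∀ m x → rem x (pOf (2 + m)) ≡ x % (7 + 4 * m)
rem-pOf m x = %-congʳ {o = x} (pOf[2+m] m)

-- An element k′ = n + 3 + g of B_[) is described by b = 2n + 1 − k′, so that g + b = n − 2.
module _ (g b : ℕ) where
  private
    m = g + b
    n = 2 + m
    p = 7 + 4 * m

  square-shift : (4 + m + g) * (4 + m + g) ≡ b * b + (g + 2) * p + (g + 2)
  square-shift = expand g b
    where
      expand : ∀ g b → (4 + (g + b) + g) * (4 + (g + b) + g) ≡ b * b + (g + 2) * (7 + 4 * (g + b)) + (g + 2)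
      expand = solve-∀

  ceilRoot⇒shifted-remainder : ∀ {M} → CeilRoot (M * p) b →
    ∃₂ λ t Q → (4 + m + g) * (4 + m + g) ≡ t + Q * p × t < p × suc g ≤ t × t < g + (b + b)
  ceilRoot⇒shifted-remainder {M} (Mp≤b² , b²+3≤Mp+2b) with m≤n⇒∃[o]m+o≡n Mp≤b²
  ... | ρ , Mp+ρ≡b² = g + 2 + ρ , g + 2 + M , shifted , t<p , g<t , t<g+2b
    where
      ρ+3≤2b : ρ + 3 ≤ b + b
      ρ+3≤2b = ≤-transfer (b²+3≤Mp+2b ⊕ ≤-reflexive Mp+ρ≡b²) (shift b ρ (M * p))
        where
          shift : ∀ b ρ X → ρ + 3 + (X + (b + b) + b * b) ≡ b + b + (b * b + 3 + (X + ρ))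
          shift = solve-∀
      shifted : (4 + m + g) * (4 + m + g) ≡ g + 2 + ρ + (g + 2 + M) * p
      shifted = trans square-shift (trans (cong (λ y → y + (g + 2) * p + (g + 2)) (sym Mp+ρ≡b²)) (regroup g b M ρ))
        where
          regroup : ∀ g b M ρ → M * (7 + 4 * (g + b)) + ρ + (g + 2) * (7 + 4 * (g + b)) + (g + 2)
                              ≡ g + 2 + ρ + (g + 2 + M) * (7 + 4 * (g + b))
          regroup = solve-∀
      t<p : g + 2 + ρ < p
      t<p = m+n≤o⇒m≤o _ (≤-transfer ρ+3≤2b (bound g b ρ))
        where
          bound : ∀ g b ρ → suc (g + 2 + ρ) + (3 * g + 2 * b + 7) + (b + b) ≡ 7 + 4 * (g + b) + (ρ + 3)
          bound = solve-∀
      g<t : suc g ≤ g + 2 + ρ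
      g<t = +≡⇒≤ (1 + ρ) (split g ρ)
        where
          split : ∀ g ρ → suc g + (1 + ρ) ≡ g + 2 + ρ
          split = solve-∀
      t<g+2b : g + 2 + ρ < g + (b + b)
      t<g+2b = ≤-transfer ρ+3≤2b (bound g b ρ)
        where
          bound : ∀ g b ρ → suc (g + 2 + ρ) + (b + b) ≡ g + (b + b) + (ρ + 3)
          bound = solve-∀

  shifted-remainder⇒ceilRoot : ∀ {t Q} → (∀ M → M * p ≢ b * b + 1) →
    (4 + m + g) * (4 + m + g) ≡ t + Q * p → t < p → suc g ≤ t → t < g + (b + b) → ∃ λ M → CeilRoot (M * p) b
  shifted-remainder⇒ceilRoot {t} {Q} nonSquare+1 x≡t+Qp t<p g<t t<g+2b with m≤n⇒∃[o]m+o≡n g<t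
  ... | t′ , refl with m≤n⇒∃[o]m+o≡n g+2≤Q
    where
      E : b * b + (g + 2) * p + (g + 2) ≡ suc g + t′ + Q * p
      E = trans (sym square-shift) x≡t+Qp
      g+2≤Q : g + 2 ≤ Q
      g+2≤Q with g + 2 ≤? Q
      ... | yes g+2≤Q = g+2≤Q
      ... | no g+2≰Q =
        contradiction (excess g b t′ Q) (≤⇒≢+suc (b * b + g + 2) (≤-reflexive E ⊕ *-monoˡ-≤ p Q≤g+1 ⊕ t<p))
        where
          Q≤g+1 : Q ≤ g + 1
          Q≤g+1 = m<1+n⇒m≤n (subst (Q <_) (+-suc g 1) (≰⇒> g+2≰Q))
          excess : ∀ g b t′ Q → let p = 7 + 4 * (g + b) in
                   b * b + (g + 2) * p + (g + 2) + Q * p + suc (suc g + t′)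
                   ≡ suc g + t′ + Q * p + (g + 1) * p + p + suc (b * b + g + 2)
          excess = solve-∀
  ... | M , refl = M , residue t′ b²+1≡t′+Mp t<g+2b
    where
      b²+1≡t′+Mp : b * b + 1 ≡ t′ + M * p
      b²+1≡t′+Mp = +-cancelʳ-≡ ((g + 2) * p + (g + 1)) _ _ (begin
          b * b + 1 + ((g + 2) * p + (g + 1))   ≡⟨ regroupˡ g b ⟩
          b * b + (g + 2) * p + (g + 2)         ≡⟨ square-shift ⟨
          (4 + m + g) * (4 + m + g)             ≡⟨ x≡t+Qp ⟩
          suc g + t′ + (g + 2 + M) * p          ≡⟨ regroupʳ g b t′ M ⟩
          t′ + M * p + ((g + 2) * p + (g + 1))  ∎)
        where
          open ≡-Reasoning
          regroupˡ : ∀ g b → let p = 7 + 4 * (g + b) in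
                     b * b + 1 + ((g + 2) * p + (g + 1)) ≡ b * b + (g + 2) * p + (g + 2)
          regroupˡ = solve-∀
          regroupʳ : ∀ g b t′ M → let p = 7 + 4 * (g + b) in
                     suc g + t′ + (g + 2 + M) * p ≡ t′ + M * p + ((g + 2) * p + (g + 1))
          regroupʳ = solve-∀
      residue : ∀ t′ → b * b + 1 ≡ t′ + M * p → suc g + t′ < g + (b + b) → CeilRoot (M * p) b
      residue zero b²+1≡Mp _ = contradiction (sym b²+1≡Mp) (nonSquare+1 M)
      residue (suc ρ) b²+1≡ρ+1+Mp t<g+2b =
        +≡⇒≤ ρ (sym b²≡Mp+ρ) , ≤-transfer (t<g+2b ⊕ ≤-reflexive b²≡Mp+ρ) (shift g b ρ (M * p))
        where
          b²≡Mp+ρ : b * b ≡ M * p + ρ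
          b²≡Mp+ρ = trans (suc-injective (trans (+-comm 1 (b * b)) b²+1≡ρ+1+Mp)) (+-comm ρ (M * p))
          shift : ∀ g b ρ X → b * b + 3 + (g + (b + b) + (X + ρ)) ≡ X + (b + b) + (suc (suc g + suc ρ) + b * b)
          shift = solve-∀

  rem-square-shifted : rem ((n + 3 + g ∸ 1) ^ 2) (pOf n) ≡ ((4 + m + g) * (4 + m + g)) % p
  rem-square-shifted = trans (rem-pOf m ((n + 3 + g ∸ 1) ^ 2))
    (cong (_% p) (trans (x^2≡x*x (n + 3 + g ∸ 1)) (cong (λ y → y * y) (k′-1 g b))))
    where
      k′-1 : ∀ g b → suc (g + b + 3 + g) ≡ 4 + (g + b) + g
      k′-1 = solve-∀

  lower-bound≡ : n + 3 + g ∸ n ∸ 2 ≡ suc g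
  lower-bound≡ = cong (_∸ 2) (∸-by {y = n} (+-assoc n 3 g))

  upper-bound≡ : 3 * n ∸ (n + 3 + g) ∸ 1 ≡ g + (b + b)
  upper-bound≡ = cong (_∸ 1) (∸-by {y = n + 3 + g} (split g b))
    where
      split : ∀ g b → 3 * (2 + (g + b)) ≡ 2 + (g + b) + 3 + g + suc (g + (b + b))
      split = solve-∀

  inB[n+3+g]⇒ceilRoot : (∀ M → M * p ≢ b * b + 1) → InB n (n + 3 + g) → ∃ λ M → CeilRoot (M * p) b
  inB[n+3+g]⇒ceilRoot nonSquare+1 (_ , _ , far , near) =
    shifted-remainder⇒ceilRoot {x % p} {x / p} nonSquare+1 (m≡m%n+[m/n]*n x p) (m%n<n x p)
      (subst₂ _≤_ lower-bound≡ rem-square-shifted far) (subst₂ _<_ rem-square-shifted upper-bound≡ near)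
    where x = (4 + m + g) * (4 + m + g)

  ceilRoot⇒inB[n+3+g] : ∀ {M} → CeilRoot (M * p) b → InB n (n + 3 + g)
  ceilRoot⇒inB[n+3+g] {M} root =
    let t , Q , x≡t+Qp , t<p , g<t , t<g+2b = ceilRoot⇒shifted-remainder {M} root
        rem≡t = trans rem-square-shifted (proj₁ (remainder-quotient-unique {x} {t} {Q} {p} x≡t+Qp t<p))
    in m≤m+n (n + 3) g , ≤-transfer (ceilRoot-positive root) (fits g b) ,
       subst₂ _≤_ (sym lower-bound≡) (sym rem≡t) g<t , subst₂ _<_ (sym rem≡t) (sym upper-bound≡) t<g+2b
    where
      x = (4 + m + g) * (4 + m + g)
      fits : ∀ g b → 2 + (g + b) + 3 + g + b ≡ 2 * (2 + (g + b)) + 1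
      fits = solve-∀

-- n = m + 2 and p = 4n − 1 = 7 + 4m; parametrising by m keeps p free of subtraction.
module Characterisation (m : ℕ) where

  n : ℕ
  n = 2 + m

  p : ℕ
  p = 7 + 4 * m

  rem-p : ∀ x → rem x (pOf n) ≡ x % p
  rem-p = rem-pOf m

  quot-p : ∀ x → quot x (pOf n) ≡ x / p
  quot-p x = /-congʳ {m = x} (pOf[2+m] m)

  level : ℕ → ℕ
  level k = mOf n k + 1

  remainder⇒roundRoot : ∀ {a r q} → a * a ≡ r + q * p → 3 * n ≤ suc a + (1 + r) → r + 3 < 3 * n + suc a →
                        RoundRoot (3 + m) ((q + 1) * p) a
  remainder⇒roundRoot {a} {r} {q} a²≡r+qp far near =
    ≤-transfer (near ⊕ ≤-reflexive a²≡r+qp) (lower m a r q) , ≤-transfer (far ⊕ ≤-reflexive (sym a²≡r+qp)) (upper m a r q)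
    where
      lower : ∀ m a r q → suc (a * a + (3 + m)) + (3 * (2 + m) + suc a + (r + q * (7 + 4 * m)))
                        ≡ (q + 1) * (7 + 4 * m) + a + (suc (r + 3) + a * a)
      lower = solve-∀
      upper : ∀ m a r q → (q + 1) * (7 + 4 * m) + (suc a + (1 + r) + a * a)
                        ≡ a * a + a + (3 + m) + (3 * (2 + m) + (r + q * (7 + 4 * m)))
      upper = solve-∀

  roundRoot⇒remainder : ∀ {a q} → RoundRoot (3 + m) ((q + 1) * p) a → a ≤ 3 + m →
                        ∃ λ r → a * a ≡ r + q * p × r < p × 3 * n ≤ suc a + (1 + r) × r + 3 < 3 * n + suc a
  roundRoot⇒remainder {a} {q} (lower , upper) a≤3+m with m≤n⇒∃[o]m+o≡n qp≤a²
    where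
      qp≤a² : q * p ≤ a * a
      qp≤a² = m+n≤o⇒m≤o _ (≤-transfer (upper ⊕ a≤3+m) (shift m a q))
        where
          shift : ∀ m a q → q * (7 + 4 * m) + (1 + 2 * m) + (a * a + a + (3 + m) + (3 + m)) ≡ a * a + ((q + 1) * (7 + 4 * m) + a)
          shift = solve-∀
  ... | r , qp+r≡a² = r , a²≡r+qp , r<p , far , near
    where
      a²≡r+qp : a * a ≡ r + q * p
      a²≡r+qp = trans (sym qp+r≡a²) (+-comm (q * p) r)
      r<p : r < p
      r<p = ≤-transfer (lower ⊕ ≤-reflexive qp+r≡a² ⊕ a≤3+m) (bound m a r q)
        where
          bound : ∀ m a r q → suc r + ((q + 1) * (7 + 4 * m) + a + a * a + (3 + m))
                            ≡ 7 + 4 * m + (suc (a * a + (3 + m)) + (q * (7 + 4 * m) + r) + a)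
          bound = solve-∀
      far : 3 * n ≤ suc a + (1 + r)
      far = ≤-transfer (upper ⊕ ≤-reflexive (sym qp+r≡a²)) (shift m a r q)
        where
          shift : ∀ m a r q → 3 * (2 + m) + (a * a + a + (3 + m) + (q * (7 + 4 * m) + r))
                            ≡ suc a + (1 + r) + ((q + 1) * (7 + 4 * m) + a * a)
          shift = solve-∀
      near : r + 3 < 3 * n + suc a
      near = ≤-transfer (lower ⊕ ≤-reflexive qp+r≡a²) (shift m a r q)
        where
          shift : ∀ m a r q → suc (r + 3) + ((q + 1) * (7 + 4 * m) + a + a * a)
                            ≡ 3 * (2 + m) + suc a + (suc (a * a + (3 + m)) + (q * (7 + 4 * m) + r))
          shift = solve-∀

  rem-square : ∀ a → rem ((suc a ∸ 1) ^ 2) (pOf n) ≡ (a * a) % p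
  rem-square a = trans (rem-p (a ^ 2)) (cong (_% p) (x^2≡x*x a))

  mOf-square : ∀ a → mOf n (suc a) ≡ (a * a) / p
  mOf-square a = trans (quot-p (a ^ 2)) (cong (_/ p) (x^2≡x*x a))

  inA⇒roundRoot : ∀ {k} → InA n k → ∃ λ a → k ≡ suc a × a ≤ 3 + m × RoundRoot (3 + m) (level k * p) a
  inA⇒roundRoot {suc zero} (s≤s () , _)
  inA⇒roundRoot {suc (suc a₀)} (_ , k≤n+2 , far , near) =
    a , refl , a≤3+m , subst (λ q → RoundRoot (3 + m) ((q + 1) * p) a) (sym (mOf-square a)) root
    where
      a = suc a₀
      r = (a * a) % p
      a≤3+m : a ≤ 3 + m
      a≤3+m = subst (a ≤_) (cong suc (+-comm m 2)) (s≤s⁻¹ k≤n+2)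
      root : RoundRoot (3 + m) ((a * a / p + 1) * p) a
      root = remainder⇒roundRoot {a} {r} {a * a / p} (m≡m%n+[m/n]*n (a * a) p)
        (∸≤⇒≤+ _ (suc a) (∸≤⇒≤+ _ 1 (subst (3 * n ∸ suc a ∸ 1 ≤_) (rem-square a) far)))
        (<∸⇒+< 3 (subst (_< 3 * n + suc a ∸ 3) (rem-square a) near))

  remainder⇒inA : ∀ {a r q} → a * a ≡ r + q * p → r < p → 3 * n ≤ suc a + (1 + r) → r + 3 < 3 * n + suc a →
                  0 < a → a ≤ 3 + m → InA n (suc a) × level (suc a) ≡ q + 1
  remainder⇒inA {a} {r} {q} a²≡r+qp r<p far near 0<a a≤3+m =
    (s≤s 0<a , suc-a≤n+2 , far′ , near′) , cong (_+ 1) level-q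
    where
      rem≡r : rem ((suc a ∸ 1) ^ 2) (pOf n) ≡ r
      rem≡r = trans (rem-square a) (proj₁ (remainder-quotient-unique {a * a} {r} {q} {p} a²≡r+qp r<p))
      level-q : mOf n (suc a) ≡ q
      level-q = trans (mOf-square a) (proj₂ (remainder-quotient-unique {a * a} {r} {q} {p} a²≡r+qp r<p))
      suc-a≤n+2 : suc a ≤ n + 2
      suc-a≤n+2 = s≤s (subst (a ≤_) (cong suc (+-comm 2 m)) a≤3+m)
      far′ : 3 * n ∸ suc a ∸ 1 ≤ rem ((suc a ∸ 1) ^ 2) (pOf n)
      far′ = subst (3 * n ∸ suc a ∸ 1 ≤_) (sym rem≡r) (m≤n+o⇒m∸n≤o _ 1 (m≤n+o⇒m∸n≤o _ (suc a) far))
      near′ : rem ((suc a ∸ 1) ^ 2) (pOf n) < 3 * n + suc a ∸ 3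
      near′ = subst (_< 3 * n + suc a ∸ 3) (sym rem≡r) (m+n≤o⇒m≤o∸n (suc r) near)

  roundRoot⇒inA : ∀ {M a} → RoundRoot (3 + m) (M * p) a → a ≤ 3 + m → InA n (suc a) × level (suc a) ≡ M
  roundRoot⇒inA {zero} root _ = contradiction (roundRoot-above root) λ ()
  roundRoot⇒inA {suc q} {a} root a≤3+m =
    let root′ = subst (λ M → RoundRoot (3 + m) (M * p) a) (+-comm 1 q) root
        r , a²≡r+qp , r<p , far , near = roundRoot⇒remainder {a} {q} root′ a≤3+m
        inA , level≡q+1 = remainder⇒inA {a} {r} {q} a²≡r+qp r<p far near (roundRoot-positive root) a≤3+m
    in inA , trans level≡q+1 (+-comm q 1)

  fVal≡n+3+g : ∀ {g a u} → g + (a + u) ≡ m → fVal n (suc a) u ≡ n + 3 + g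
  fVal≡n+3+g {g} {a} {u} g+a+u≡m =
    trans (∸-+-assoc (2 * n + 2) u (suc a))
          (∸-by {y = u + suc a} (subst (λ m → 2 * (2 + m) + 2 ≡ u + suc a + (2 + m + 3 + g)) g+a+u≡m (split g a u)))
    where
      split : ∀ g a u → 2 * (2 + (g + (a + u))) + 2 ≡ u + suc a + (2 + (g + (a + u)) + 3 + g)
      split = solve-∀

  u0Cond⇔ : ∀ a x → U0Cond n (suc a) x ⇔ (level (suc a) * p ≤ (a + x) * (a + x) + 1)
  u0Cond⇔ a x = mk⇔ (subst₂ _≤_ Mp≡ square≡) (subst₂ _≤_ (sym Mp≡) (sym square≡))
    where
      Mp≡ : level (suc a) * pOf n ≡ level (suc a) * p
      Mp≡ = cong (level (suc a) *_) (pOf[2+m] m)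
      square≡ : (a + x) ^ 2 + 1 ≡ (a + x) * (a + x) + 1
      square≡ = cong (_+ 1) (x^2≡x*x (a + x))

  ceilRoot⇒inB : ∀ {g b M} → g + b ≡ m → CeilRoot (M * p) b → InB n (n + 3 + g)
  ceilRoot⇒inB {g} {b} {M} g+b≡m =
    subst (λ m → CeilRoot (M * (7 + 4 * m)) b → InB (2 + m) (2 + m + 3 + g)) g+b≡m (ceilRoot⇒inB[n+3+g] g b {M})

  ceilRoot⇒isU0 : ∀ {a u} → CeilRoot (level (suc a) * p) (a + u) → a + u ≤ m → IsU0 n (suc a) u
  ceilRoot⇒isU0 {a} {u} ceil a+u≤m =
    ≤-trans (m≤n+m u a) (≤-trans a+u≤m (≤-trans (m≤n+m m 2) (m≤m+n n 2))) ,
    Equivalence.from (u0Cond⇔ a u) (≤-trans (proj₁ ceil) (m≤m+n _ 1)) ,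
    λ x x<u → <⇒≱ (ceilRoot-below ceil (+-monoʳ-< a x<u)) ∘ Equivalence.to (u0Cond⇔ a x)

  isU0⇒ceilRoot : ∀ {a u} → (∀ x → level (suc a) * p ≢ x * x + 1) → RoundRoot (3 + m) (level (suc a) * p) a →
                  IsU0 n (suc a) u → CeilRoot (level (suc a) * p) (a + u)
  isU0⇒ceilRoot {a} {u} nonSquare+1 root (_ , cond , minimal) =
    ceilRoot-least nonSquare+1 (≤-trans (s≤s (s≤s z≤n)) (roundRoot-above root)) (Equivalence.to (u0Cond⇔ a u) cond)
      (below-+ (λ x → roundRoot-below root (s≤s z≤n)) (λ x x<u → ≰⇒> (minimal x x<u ∘ Equivalence.from (u0Cond⇔ a x))))

FBijective : ℕ → ℕ → ℕ → Set
FBijective n y z =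
  ((k : ℕ) → InA' n y z k → Σ[ u ∈ ℕ ] (IsU0 n k u × InB n (fVal n k u)))
  × ((k k′ u u′ : ℕ) → InA' n y z k → InA' n y z k′ → IsU0 n k u → IsU0 n k′ u′ →
       fVal n k u ≡ fVal n k′ u′ → k ≡ k′)
  × ((b : ℕ) → InB n b → Σ[ k ∈ ℕ ] Σ[ u ∈ ℕ ] (InA' n y z k × IsU0 n k u × fVal n k u ≡ b))

module Bijection (m : ℕ) (p∤x*x+1 : ∀ x → ¬ (7 + 4 * m) ∣ x * x + 1) where

  open Characterisation m

  nonSquare+1 : ∀ M x → M * p ≢ x * x + 1
  nonSquare+1 M x Mp≡x²+1 = p∤x*x+1 x (divides M (sym Mp≡x²+1))

  top : ℕ
  top = m * m / p

  m²≡ρ+top*p : m * m ≡ m * m % p + top * p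
  m²≡ρ+top*p = m≡m%n+[m/n]*n (m * m) p

  ρ+2≤p : m * m % p + 2 ≤ p
  ρ+2≤p = subst (_≤ p) (+-comm 2 ρ) (≤∧≢⇒< (m%n<n (m * m) p) ρ+1≢p)
    where
      ρ = m * m % p
      ρ+1≢p : suc ρ ≢ p
      ρ+1≢p ρ+1≡p = nonSquare+1 (suc top) m (sym (begin
          m * m + 1           ≡⟨ cong (_+ 1) m²≡ρ+top*p ⟩
          ρ + top * p + 1     ≡⟨ +-comm (ρ + top * p) 1 ⟩
          suc ρ + top * p     ≡⟨ cong (_+ top * p) ρ+1≡p ⟩
          suc top * p         ∎))
        where open ≡-Reasoning

  level≤top+2 : ∀ {M a} → RoundRoot (3 + m) (M * p) a → a ≤ 3 + m → M ≤ top + 2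
  level≤top+2 {M} {a} (_ , upper) a≤3+m with M ≤? top + 2
  ... | yes M≤top+2 = M≤top+2
  ... | no M≰top+2 with m≤n⇒∃[o]m+o≡n (≰⇒> M≰top+2)
  ...   | k , refl = contradiction (excess m top (m * m % p) k)
                       (≤⇒≢+suc (k * p) (upper′ ⊕ ρ+2≤p ⊕ ≤-reflexive m²≡ρ+top*p))
    where
      upper′ : (suc (top + 2) + k) * p ≤ (3 + m) * (3 + m) + (3 + m) + (3 + m)
      upper′ = ≤-trans upper (+-monoˡ-≤ (3 + m) (*-mono-≤ a≤3+m a≤3+m ⊕ a≤3+m))
      excess : ∀ m top ρ k → (suc (top + 2) + k) * (7 + 4 * m) + (ρ + 2) + m * m
                           ≡ (3 + m) * (3 + m) + (3 + m) + (3 + m) + (7 + 4 * m) + (ρ + top * (7 + 4 * m)) + suc (k * (7 + 4 * m))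
      excess = solve-∀

  root≤3+m : ∀ {M a} → RoundRoot (3 + m) (M * p) a → M ≤ top + 2 → a ≤ 3 + m
  root≤3+m {M} {a} (lower , _) M≤top+2 with a ≤? 3 + m
  ... | yes a≤3+m = a≤3+m
  ... | no a≰3+m with m≤n⇒∃[o]m+o≡n (≰⇒> a≰3+m)
  ...   | d , refl = contradiction (excess m d (M * p) top (m * m % p))
                       (≤⇒≢+suc (1 + (7 + 2 * m) * d + d * d + m * m % p)
                                (lower ⊕ *-monoˡ-≤ p M≤top+2 ⊕ ≤-reflexive (sym m²≡ρ+top*p)))
    where
      excess : ∀ m d Mp top ρ → suc ((suc (3 + m) + d) * (suc (3 + m) + d) + (3 + m)) + Mp + (ρ + top * (7 + 4 * m))
                              ≡ Mp + (suc (3 + m) + d) + (top + 2) * (7 + 4 * m) + m * m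
                                + suc (1 + (7 + 2 * m) * d + d * d + ρ)
      excess = solve-∀

  levels-apart : ∀ {M M′} → M < M′ → M * p + p ≤ M′ * p
  levels-apart {M} {M′} M<M′ = subst (_≤ M′ * p) (+-comm p (M * p)) (*-monoˡ-≤ p M<M′)

  roundRoot-level-< : ∀ {M M′ a a′} → RoundRoot (3 + m) (M * p) a → RoundRoot (3 + m) (M′ * p) a′ → a ≤ 3 + m → M < M′ → a < a′
  roundRoot-level-< {M} {a = a} root root′ a≤3+m M<M′ =
    roundRoot-mono-< root root′ (≤-trans (+-monoʳ-≤ (M * p) 2a≤p) (levels-apart M<M′))
    where
      2a≤p : a + a ≤ p
      2a≤p = ≤-trans (a≤3+m ⊕ a≤3+m) (+≡⇒≤ (1 + 2 * m) (widths m))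
        where
          widths : ∀ m → 3 + m + (3 + m) + (1 + 2 * m) ≡ 7 + 4 * m
          widths = solve-∀

  roundRoot-level-injective : ∀ {M M′ a} → RoundRoot (3 + m) (M * p) a → RoundRoot (3 + m) (M′ * p) a → a ≤ 3 + m → M ≡ M′
  roundRoot-level-injective root root′ a≤3+m with <-cmp _ _
  ... | tri< M<M′ _ _ = contradiction (roundRoot-level-< root root′ a≤3+m M<M′) (<-irrefl refl)
  ... | tri≈ _ M≡M′ _ = M≡M′
  ... | tri> _ _ M′<M = contradiction (roundRoot-level-< root′ root a≤3+m M′<M) (<-irrefl refl)

  ceilRoot-level-≮ : ∀ {M M′ b} → CeilRoot (M * p) b → CeilRoot (M′ * p) b → b ≤ m → ¬ M < M′
  ceilRoot-level-≮ {M} {M′} {b} ceil ceil′ b≤m M<M′ =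
    contradiction (excess m (M * p) (M′ * p) b)
      (≤⇒≢+suc (2 * m + 9) (levels-apart M<M′ ⊕ ceilRoot-width {M * p} {M′ * p} {b} ceil ceil′ ⊕ (b≤m ⊕ b≤m)))
    where
      excess : ∀ m Mp M′p b → Mp + (7 + 4 * m) + (M′p + 3) + (b + b) ≡ M′p + (Mp + (b + b)) + (m + m) + suc (2 * m + 9)
      excess = solve-∀

  ceilRoot-level-injective : ∀ {M M′ b} → CeilRoot (M * p) b → CeilRoot (M′ * p) b → b ≤ m → M ≡ M′
  ceilRoot-level-injective ceil ceil′ b≤m with <-cmp _ _
  ... | tri< M<M′ _ _ = contradiction M<M′ (ceilRoot-level-≮ ceil ceil′ b≤m)
  ... | tri≈ _ M≡M′ _ = M≡M′
  ... | tri> _ _ M′<M = contradiction M′<M (ceilRoot-level-≮ ceil′ ceil b≤m)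

  inB⇒ceilRoot : ∀ {k′} → InB n k′ → ∃₂ λ g b → k′ ≡ n + 3 + g × g + b ≡ m × ∃ λ M → CeilRoot (M * p) b
  inB⇒ceilRoot {k′} inB@(n+3≤k′ , k′≤2n , _) =
    let g , n+3+g≡k′ = m≤n⇒∃[o]m+o≡n n+3≤k′
        g≤m = <⇒≤ (≤-transfer (subst (_≤ 2 * n) (sym n+3+g≡k′) k′≤2n) (shift m g))
        b = m ∸ g
        g+b≡m = m+[n∸m]≡n g≤m
        inB′ = subst (λ m → InB (2 + m) (2 + m + 3 + g)) (sym g+b≡m) (subst (InB n) (sym n+3+g≡k′) inB)
        nonSquare+1′ = subst (λ m → ∀ M → M * (7 + 4 * m) ≢ b * b + 1) (sym g+b≡m) (λ M → nonSquare+1 M b)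
    in g , b , sym n+3+g≡k′ , g+b≡m ,
       subst (λ m → ∃ λ M → CeilRoot (M * (7 + 4 * m)) b) g+b≡m (inB[n+3+g]⇒ceilRoot g b nonSquare+1′ inB′)
    where
      shift : ∀ m g → suc g + 2 * (2 + m) ≡ m + (2 + m + 3 + g)
      shift = solve-∀

  roundRoot-of-level : ∀ M → 0 < M → ∃ (RoundRoot (3 + m) (M * p))
  roundRoot-of-level (suc M) _ = roundRoot-exists (≤-trans (+≡⇒≤ (3 * m + 3) (shift m)) (m≤m+n p (M * p)))
    where
      shift : ∀ m → suc (3 + m) + (3 * m + 3) ≡ 7 + 4 * m
      shift = solve-∀

  y-root : ∃ (RoundRoot (3 + m) ((top + 2) * p))
  y-root = roundRoot-of-level (top + 2) (≤-trans (s≤s z≤n) (m≤n+m 2 top))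

  z-root : ∃ (RoundRoot (3 + m) ((top + 1) * p))
  z-root = roundRoot-of-level (top + 1) (m≤n+m 1 top)

  y z : ℕ
  y = suc (proj₁ y-root)
  z = suc (proj₁ z-root)

  y-root≤3+m : proj₁ y-root ≤ 3 + m
  y-root≤3+m = root≤3+m (proj₂ y-root) ≤-refl

  z-root≤3+m : proj₁ z-root ≤ 3 + m
  z-root≤3+m = root≤3+m (proj₂ z-root) (+-monoʳ-≤ top (n≤1+n 1))

  level≢top+j : ∀ {k a j} → RoundRoot (3 + m) (level k * p) a → a ≤ 3 + m → (root : ∃ (RoundRoot (3 + m) ((top + j) * p))) →
                k ≡ suc a → k ≢ suc (proj₁ root) → level k ≢ top + j
  level≢top+j {a = a} root a≤3+m (a′ , root′) refl k≢ level≡ =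
    k≢ (cong suc (roundRoot-unique (subst (λ M → RoundRoot (3 + m) (M * p) a) level≡ root) root′))

  LowRoot : ℕ → Set
  LowRoot k = ∃ λ a → k ≡ suc a × a ≤ 3 + m × RoundRoot (3 + m) (level k * p) a × level k ≤ top

  inA′⇒lowRoot : ∀ {k} → InA n k → k ≢ y → k ≢ z → LowRoot k
  inA′⇒lowRoot {k} inA k≢y k≢z =
    let a , k≡1+a , a≤3+m , root = inA⇒roundRoot inA
        level≤top+2 = level≤top+2 root a≤3+m
        level≢top+2 = level≢top+j root a≤3+m y-root k≡1+a k≢y
        level≢top+1 = level≢top+j root a≤3+m z-root k≡1+a k≢z
        level≤top+1 = m<1+n⇒m≤n (subst (level k <_) (+-suc top 1) (≤∧≢⇒< level≤top+2 level≢top+2))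
        level≤top = m<1+n⇒m≤n (subst (level k <_) (+-comm top 1) (≤∧≢⇒< level≤top+1 level≢top+1))
    in a , k≡1+a , a≤3+m , root , level≤top

  twoLargest : TwoLargest n y z
  twoLargest =
    proj₁ (roundRoot⇒inA {top + 2} (proj₂ y-root) y-root≤3+m) ,
    proj₁ (roundRoot⇒inA {top + 1} (proj₂ z-root) z-root≤3+m) ,
    s≤s (roundRoot-level-< {top + 1} {top + 2} (proj₂ z-root) (proj₂ y-root) z-root≤3+m (+-monoʳ-< top ≤-refl)) ,
    below-z
    where
      below-z : ∀ k → InA n k → k ≢ y → k ≢ z → k < z
      below-z k inA k≢y k≢z =
        let a , k≡1+a , a≤3+m , root , level≤top = inA′⇒lowRoot inA k≢y k≢z
            level<top+1 = subst (level k <_) (+-comm 1 top) (s≤s level≤top)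
        in subst (_< z) (sym k≡1+a) (s≤s (roundRoot-level-< {level k} {top + 1} root (proj₂ z-root) a≤3+m level<top+1))

  level≤top⇒ceilRoot : ∀ {M} → 0 < M → M ≤ top → ∃ λ b → CeilRoot (M * p) b × b ≤ m
  level≤top⇒ceilRoot {M} 0<M M≤top =
    let b , ceil = ceilRoot-exists (nonSquare+1 M) (≤-trans 0<M (m≤m*n M p))
    in b , ceil , ceilRoot-≤ ceil (≤/⇒*≤ M≤top)

  f-maps-into-B : ∀ k → InA' n y z k → Σ[ u ∈ ℕ ] (IsU0 n k u × InB n (fVal n k u))
  f-maps-into-B k (inA , k≢y , k≢z) = image (inA′⇒lowRoot inA k≢y k≢z)
    where
      image : LowRoot k → Σ[ u ∈ ℕ ] (IsU0 n k u × InB n (fVal n k u))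
      image (a , refl , a≤3+m , root , level≤top) =
        let b , ceil , b≤m = level≤top⇒ceilRoot {level k} (m≤n+m 1 (mOf n k)) level≤top
            u , a+u≡b = m≤n⇒∃[o]m+o≡n (<⇒≤ (roundRoot-ceilRoot-< root ceil (≤-trans b≤m (m≤n+m m 3))))
            g+a+u≡m = trans (cong (m ∸ b +_) a+u≡b) (m∸n+n≡m b≤m)
        in u , ceilRoot⇒isU0 {a} {u} (subst (CeilRoot (level k * p)) (sym a+u≡b) ceil) (subst (_≤ m) (sym a+u≡b) b≤m) ,
           subst (InB n) (sym (fVal≡n+3+g {m ∸ b} {a} {u} g+a+u≡m)) (ceilRoot⇒inB {m ∸ b} {b} {level k} (m∸n+n≡m b≤m) ceil)

  f-injective : ∀ k k′ u u′ → InA' n y z k → InA' n y z k′ → IsU0 n k u → IsU0 n k′ u′ →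
                fVal n k u ≡ fVal n k′ u′ → k ≡ k′
  f-injective k k′ u u′ (inA , k≢y , k≢z) (inA′ , k′≢y , k′≢z) =
    injective (inA′⇒lowRoot inA k≢y k≢z) (inA′⇒lowRoot inA′ k′≢y k′≢z)
    where
      injective : LowRoot k → LowRoot k′ → IsU0 n k u → IsU0 n k′ u′ → fVal n k u ≡ fVal n k′ u′ → k ≡ k′
      injective (a , refl , _ , root , level≤top) (a′ , refl , _ , root′ , level′≤top) isU0 isU0′ f≡f′ = cong suc a≡a′
        where
          ceil : CeilRoot (level k * p) (a + u)
          ceil = isU0⇒ceilRoot {a} {u} (nonSquare+1 (level k)) root isU0
          ceil′ : CeilRoot (level k′ * p) (a′ + u′)
          ceil′ = isU0⇒ceilRoot {a′} {u′} (nonSquare+1 (level k′)) root′ isU0′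
          b≤m : a + u ≤ m
          b≤m = ceilRoot-≤ ceil (≤/⇒*≤ level≤top)
          b′≤m : a′ + u′ ≤ m
          b′≤m = ceilRoot-≤ ceil′ (≤/⇒*≤ level′≤top)
          g≡g′ : m ∸ (a + u) ≡ m ∸ (a′ + u′)
          g≡g′ = +-cancelˡ-≡ (n + 3) _ _ (begin
              n + 3 + (m ∸ (a + u))     ≡⟨ fVal≡n+3+g {m ∸ (a + u)} {a} {u} (m∸n+n≡m b≤m) ⟨
              fVal n k u                ≡⟨ f≡f′ ⟩
              fVal n k′ u′              ≡⟨ fVal≡n+3+g {m ∸ (a′ + u′)} {a′} {u′} (m∸n+n≡m b′≤m) ⟩
              n + 3 + (m ∸ (a′ + u′))   ∎)
            where open ≡-Reasoning
          b≡b′ : a + u ≡ a′ + u′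
          b≡b′ = ∸-cancelˡ-≡ b≤m b′≤m g≡g′
          level≡ : level k ≡ level k′
          level≡ = ceilRoot-level-injective {level k} {level k′} ceil (subst (CeilRoot (level k′ * p)) (sym b≡b′) ceil′) b≤m
          a≡a′ : a ≡ a′
          a≡a′ = roundRoot-unique root (subst (λ M → RoundRoot (3 + m) (M * p) a′) (sym level≡) root′)

  lowRoot≢highRoot : ∀ {M a j} → RoundRoot (3 + m) (M * p) a → a ≤ 3 + m → M ≤ top → 0 < j →
              (root : ∃ (RoundRoot (3 + m) ((top + j) * p))) → suc a ≢ suc (proj₁ root)
  lowRoot≢highRoot {M} {a} {j} root a≤3+m M≤top 0<j (a′ , root′) 1+a≡1+a′ =
    <⇒≱ (m<m+n top 0<j) (subst (_≤ top) M≡top+j M≤top)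
    where
      M≡top+j : M ≡ top + j
      M≡top+j = roundRoot-level-injective root
                  (subst (RoundRoot (3 + m) ((top + j) * p)) (sym (suc-injective 1+a≡1+a′)) root′) a≤3+m

  f-surjective : ∀ k′ → InB n k′ → Σ[ k ∈ ℕ ] Σ[ u ∈ ℕ ] (InA' n y z k × IsU0 n k u × fVal n k u ≡ k′)
  f-surjective k′ inB =
    let g , b , k′≡n+3+g , g+b≡m , M , ceil = inB⇒ceilRoot inB
        b≤m = subst (b ≤_) g+b≡m (m≤n+m b g)
        M≤top = *≤⇒≤/ {M} (≤-trans (proj₁ ceil) (*-mono-≤ b≤m b≤m))
        a , root = roundRoot-of-level M (level-positive {M} (ceilRoot-above {M * p} {b} ceil))
        a≤3+m = root≤3+m {M} root (≤-trans M≤top (m≤m+n top 2))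
        inA , level≡M = roundRoot⇒inA {M} {a} root a≤3+m
        u , a+u≡b = m≤n⇒∃[o]m+o≡n (<⇒≤ (roundRoot-ceilRoot-< {3 + m} {M * p} {a} {b} root ceil (≤-trans b≤m (m≤n+m m 3))))
        ceil′ = subst₂ (λ M b → CeilRoot (M * p) b) (sym level≡M) (sym a+u≡b) ceil
    in suc a , u ,
       (inA , lowRoot≢highRoot {M} root a≤3+m M≤top (s≤s z≤n) y-root ,
              lowRoot≢highRoot {M} root a≤3+m M≤top (s≤s z≤n) z-root) ,
       ceilRoot⇒isU0 {a} {u} ceil′ (subst (_≤ m) (sym a+u≡b) b≤m) ,
       trans (fVal≡n+3+g {g} {a} {u} (trans (cong (g +_) a+u≡b) g+b≡m)) (sym k′≡n+3+g)
    where
      level-positive : ∀ {M} → 1 < M * p → 0 < M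
      level-positive {suc M} _ = s≤s z≤n

  conclusion : (Σ[ y ∈ ℕ ] Σ[ z ∈ ℕ ] TwoLargest n y z) × (∀ y′ z′ → TwoLargest n y′ z′ → FBijective n y′ z′)
  conclusion = (y , z , twoLargest) , λ y′ z′ twoLargest′ → case twoLargest-unique {n} twoLargest twoLargest′ of λ where
    (refl , refl) → f-maps-into-B , f-injective , f-surjective

theorem4p4 : (n : ℕ) → 3 < n → Prime (4 * n ∸ 1) →
    (Σ[ y ∈ ℕ ] Σ[ z ∈ ℕ ] TwoLargest n y z)
    × ((y z : ℕ) → TwoLargest n y z →
        ((k : ℕ) → InA' n y z k → Σ[ u ∈ ℕ ] (IsU0 n k u × InB n (fVal n k u)))
        × ((k k′ u u′ : ℕ) → InA' n y z k → InA' n y z k′ → IsU0 n k u → IsU0 n k′ u′ →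
             fVal n k u ≡ fVal n k′ u′ → k ≡ k′)
        × ((b : ℕ) → InB n b →
             Σ[ k ∈ ℕ ] Σ[ u ∈ ℕ ] (InA' n y z k × IsU0 n k u × fVal n k u ≡ b)))
-- The argument works for every n ≥ 2; the hypothesis 3 < n is only used to exclude n ≤ 1.
theorem4p4 zero () _
theorem4p4 (suc zero) (s≤s ()) _
theorem4p4 (suc (suc m)) _ p-prime =
  Bijection.conclusion m (prime≡3mod4⇒∤x*x+1 {n = 2 + m} (subst Prime (pOf[2+m] m) p-prime) (p+1≡4n m))
  where
    p+1≡4n : ∀ m → 7 + 4 * m + 1 ≡ 4 * (2 + m)
    p+1≡4n = solve-∀
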